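{- Let $t$ be a first-order term with $k\geq 0$ variables. Suppose either (a) $f$ is a non-constant function symbol not occurring in $t$, or (b) $c_1,\dots,c_k$ are distinct constants not occurring in $t$. Then there exists an instance of $t$ which is not unifiable with any term $s$ such that (i) $t$ is not an instance of $s$, and (ii) in case (a) $f$ does not occur in $s$, respectively in case (b) none of $c_1,\dots,c_k$ occurs in $s$.
   Context: Terms are built over a fixed alphabet of function symbols (including constants) and variables. A term $u$ is an instance of $t$ if $u=t\sigma$ for some substitution $\sigma$; two terms are unifiable if some substitution makes them identical. -}

module Defs where

open import Data.Nat using (ℕ; _≟_)
open import Data.Vec using (Vec; []; _∷_)
open import Data.List using (List; []; _∷_; _++_; length; deduplicate)
open import Data.Product using (Σ; ∃; _×_; _,_)
open import Data.Sum using (_⊎_)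
open import Relation.Binary.PropositionalEquality using (_≡_)

-- A fixed (arbitrary) alphabet: function symbols F with arities ar
-- (constants are symbols of arity 0). Variables are natural numbers.
module _ {F : Set} (ar : F → ℕ) where

  data Term : Set where
    var : ℕ → Term
    fun : (f : F) → Vec Term (ar f) → Term

  Subst : Set
  Subst = ℕ → Term

  mutual
    _[_] : Term → Subst → Term
    var x [ σ ] = σ x
    fun f ts [ σ ] = fun f (ts [ σ ]*)

    _[_]* : ∀ {n} → Vec Term n → Subst → Vec Term n
    [] [ σ ]* = []
    (t ∷ ts) [ σ ]* = (t [ σ ]) ∷ (ts [ σ ]*)

  IsInstance : Term → Term → Set
  IsInstance u t = Σ Subst λ σ → u ≡ t [ σ ]

  Unifiable : Term → Term → Set
  Unifiable u s = Σ Subst λ σ → u [ σ ] ≡ s [ σ ]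

  mutual
    data Occurs (g : F) : Term → Set where
      here  : ∀ (ts : Vec Term (ar g)) → Occurs g (fun g ts)
      there : ∀ {f} {ts : Vec Term (ar f)} → OccursAny g ts → Occurs g (fun f ts)

    data OccursAny (g : F) : ∀ {n} → Vec Term n → Set where
      head : ∀ {n t} {ts : Vec Term n} → Occurs g t → OccursAny g (t ∷ ts)
      tail : ∀ {n t} {ts : Vec Term n} → OccursAny g ts → OccursAny g (t ∷ ts)

  mutual
    vars : Term → List ℕ
    vars (var x) = x ∷ []
    vars (fun f ts) = vars* ts

    vars* : ∀ {n} → Vec Term n → List ℕ
    vars* [] = []
    vars* (t ∷ ts) = vars t ++ vars* ts

  numVars : Term → ℕ
  numVars t = length (deduplicate _≟_ (vars t))

{-# OPTIONS --safe #-}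
-- Take u = t σ, where σ sends the variable x to a term headed by a fresh symbol:
-- in case (a) the tower f^(x+1)(z) over a fixed variable z, whose size after any
-- substitution still grows with x; in case (b) the constant naming x.  Hence σθ
-- is injective on terms over the symbols of t, for every θ.  Now let u θ = s θ
-- with s avoiding the fresh symbols.  Where s has a function symbol, t has the
-- same one, because σθ sends variables of t to freshly headed terms.  Where s has
-- a variable y, the subterm r of t at that position satisfies θ y = r σ θ, so by
-- injectivity r does not depend on the occurrence of y; hence y ↦ r matches s
-- onto t.
module Submission where

open import Defs
open import Data.Nat using (ℕ; _≤_; _<_; zero; suc; _+_; s≤s; _≟_)
open import Data.Nat.Properties using (≤-trans; <-trans; <⇒≢; m≤m+n; m≤n+m; suc-injective)
open import Data.Fin using (Fin; fromℕ<) renaming (zero to fzero; suc to fsuc)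
open import Data.Product using (Σ; ∃; ∃₂; _×_; _,_; proj₁; proj₂)
open import Data.Sum using (inj₁; inj₂)
open import Data.Maybe using (Maybe; just; nothing; fromMaybe; _<∣>_)
open import Data.Vec using (Vec; []; _∷_; lookup; replicate)
open import Data.Vec.Properties using (∷-injective; lookup-replicate)
open import Data.Vec.Relation.Unary.All using (All; []; _∷_)
open import Data.Vec.Relation.Unary.All.Properties using (lookup⁻)
open import Data.List using (List; deduplicate)
import Data.List as List
open import Data.List.Membership.Propositional using (_∈_)
open import Data.List.Membership.Propositional.Properties using (∈-++⁺ˡ; ∈-++⁺ʳ; ∈-++⁻; ∈-deduplicate⁺)
open import Data.List.Membership.DecPropositional _≟_ using (_∈?_)
open import Data.List.Relation.Binary.Subset.Propositional using (_⊆_)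
open import Data.List.Relation.Unary.Any using (here; there; index)
open import Data.List.Relation.Unary.Any.Properties using (lookup-index)
open import Data.Empty using (⊥-elim)
open import Relation.Binary.PropositionalEquality using (_≡_; _≢_; refl; sym; trans; cong; cong₂; subst; module ≡-Reasoning)
open import Relation.Nullary using (¬_; yes; no)
open import Function using (id; _∘_)
open import Function.Definitions using (Injective)

module _ {F : Set} (ar : F → ℕ) where

  private
    Tm : Set
    Tm = Term ar

    infixl 8 _⟨_⟩ _⟨_⟩*

    _⟨_⟩ : Tm → Subst ar → Tm
    _⟨_⟩ = _[_] ar

    _⟨_⟩* : ∀ {n} → Vec Tm n → Subst ar → Vec Tm n
    _⟨_⟩* = _[_]* ar

  fun-injectiveˡ : ∀ {g h} {vs : Vec Tm (ar g)} {ws : Vec Tm (ar h)} → fun g vs ≡ fun h ws → g ≡ h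
  fun-injectiveˡ refl = refl

  fun-injectiveʳ : ∀ {g} {vs ws : Vec Tm (ar g)} → fun g vs ≡ fun g ws → vs ≡ ws
  fun-injectiveʳ refl = refl

  occursAny-lookup : ∀ {g n} {ts : Vec Tm n} (i : Fin n) → Occurs ar g (lookup ts i) → OccursAny ar g ts
  occursAny-lookup {ts = _ ∷ _} fzero    o = head o
  occursAny-lookup {ts = _ ∷ _} (fsuc i) o = tail (occursAny-lookup i o)

  occurs-lookup : ∀ {g h} {ts : Vec Tm (ar h)} (i : Fin (ar h)) → Occurs ar g (lookup ts i) → Occurs ar g (fun h ts)
  occurs-lookup i o = there (occursAny-lookup i o)

  vars-lookup-⊆ : ∀ {n} (ts : Vec Tm n) (i : Fin n) → vars ar (lookup ts i) ⊆ vars* ar ts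
  vars-lookup-⊆ (t ∷ ts) fzero    = ∈-++⁺ˡ
  vars-lookup-⊆ (t ∷ ts) (fsuc i) = ∈-++⁺ʳ (vars ar t) ∘ vars-lookup-⊆ ts i

  replicate-⟨⟩* : ∀ n (v : Tm) (θ : Subst ar) → replicate n v ⟨ θ ⟩* ≡ replicate n (v ⟨ θ ⟩)
  replicate-⟨⟩* zero    v θ = refl
  replicate-⟨⟩* (suc n) v θ = cong (v ⟨ θ ⟩ ∷_) (replicate-⟨⟩* n v θ)

  mutual
    size : Tm → ℕ
    size (var _)    = 1
    size (fun _ ts) = suc (size* ts)

    size* : ∀ {n} → Vec Tm n → ℕ
    size* []       = 0
    size* (t ∷ ts) = size t + size* ts

  size-lookup-< : ∀ {g} (ts : Vec Tm (ar g)) (i : Fin (ar g)) → size (lookup ts i) < size (fun g ts)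
  size-lookup-< ts i = s≤s (size-lookup-≤ ts i)
    where
    size-lookup-≤ : ∀ {n} (ts : Vec Tm n) (i : Fin n) → size (lookup ts i) ≤ size* ts
    size-lookup-≤ (t ∷ ts) fzero    = m≤m+n (size t) (size* ts)
    size-lookup-≤ (t ∷ ts) (fsuc i) = ≤-trans (size-lookup-≤ ts i) (m≤n+m (size* ts) (size t))

  mutual
    matchVar : Tm → Tm → ℕ → Maybe Tm
    matchVar (var y′) t y with y ≟ y′
    ... | yes _ = just t
    ... | no _  = nothing
    matchVar (fun _ ss) (var _)    y = nothing
    matchVar (fun _ ss) (fun _ ts) y = matchVar* ss ts y

    matchVar* : ∀ {m n} → Vec Tm m → Vec Tm n → ℕ → Maybe Tm
    matchVar* (s ∷ ss) (t ∷ ts) y = matchVar s t y <∣> matchVar* ss ts y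
    matchVar* _        _        y = nothing

  module Matching
    (σ : Subst ar) (P Q : Tm → Set)
    (P-args : ∀ {g} {ts : Vec Tm (ar g)} → P (fun g ts) → All P ts)
    (Q-args : ∀ {g} {ts : Vec Tm (ar g)} → Q (fun g ts) → All Q ts)
    (Q⇒P : ∀ {t} → Q t → P t)
    (σ-head : ∀ {x} → Q (var x) →
      ∃₂ λ h (us : Vec Tm (ar h)) → σ x ≡ fun h us × (∀ {vs} → ¬ P (fun h vs)))
    (σ-injective : ∀ θ {x y} → Q (var x) → Q (var y) → σ x ⟨ θ ⟩ ≡ σ y ⟨ θ ⟩ → x ≡ y)
    where

    module _ (θ : Subst ar) where

      σθ-apart : ∀ {x g} {vs ws : Vec Tm (ar g)} → Q (var x) → P (fun g vs) → σ x ⟨ θ ⟩ ≢ fun g ws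
      σθ-apart qx pv e with σ-head qx
      ... | h , us , σx≡ , ¬P with fun-injectiveˡ (trans (cong (_⟨ θ ⟩) (sym σx≡)) e)
      ... | refl = ¬P pv

      mutual
        σθ-injective : ∀ {t₁ t₂} → Q t₁ → Q t₂ → t₁ ⟨ σ ⟩ ⟨ θ ⟩ ≡ t₂ ⟨ σ ⟩ ⟨ θ ⟩ → t₁ ≡ t₂
        σθ-injective {var x}    {var y}    q₁ q₂ e = cong var (σ-injective θ q₁ q₂ e)
        σθ-injective {var x}    {fun g ts} q₁ q₂ e = ⊥-elim (σθ-apart q₁ (Q⇒P q₂) e)
        σθ-injective {fun g ts} {var y}    q₁ q₂ e = ⊥-elim (σθ-apart q₂ (Q⇒P q₁) (sym e))
        σθ-injective {fun g ts} {fun h us} q₁ q₂ e with fun-injectiveˡ e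
        ... | refl = cong (fun g) (σθ-injective* (Q-args q₁) (Q-args q₂) (fun-injectiveʳ e))

        σθ-injective* : ∀ {n} {ts us : Vec Tm n} → All Q ts → All Q us →
                        ts ⟨ σ ⟩* ⟨ θ ⟩* ≡ us ⟨ σ ⟩* ⟨ θ ⟩* → ts ≡ us
        σθ-injective* {ts = []}    {[]}    _          _          _ = refl
        σθ-injective* {ts = _ ∷ _} {_ ∷ _} (q₁ ∷ qs₁) (q₂ ∷ qs₂) e =
          let e₁ , e₂ = ∷-injective e in cong₂ _∷_ (σθ-injective q₁ q₂ e₁) (σθ-injective* qs₁ qs₂ e₂)

      Admissible : ℕ → Tm → Set
      Admissible y r = Q r × θ y ≡ r ⟨ σ ⟩ ⟨ θ ⟩

      mutual
        matchVar-admissible : ∀ {s t y r} → P s → Q t → s ⟨ θ ⟩ ≡ t ⟨ σ ⟩ ⟨ θ ⟩ →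
                              matchVar s t y ≡ just r → Admissible y r
        matchVar-admissible {var y′} {t} {y} _ qt e m with y ≟ y′
        matchVar-admissible _ qt e refl | yes refl = qt , e
        matchVar-admissible _ _  _ ()   | no _
        matchVar-admissible {fun g ss} {var x}    _  _  _ ()
        matchVar-admissible {fun g ss} {fun h ts} ps qt e m with fun-injectiveˡ e
        ... | refl = matchVar*-admissible (P-args ps) (Q-args qt) (fun-injectiveʳ e) m

        matchVar*-admissible : ∀ {n} {ss ts : Vec Tm n} {y r} → All P ss → All Q ts →
                               ss ⟨ θ ⟩* ≡ ts ⟨ σ ⟩* ⟨ θ ⟩* → matchVar* ss ts y ≡ just r → Admissible y r
        matchVar*-admissible {ss = s ∷ ss} {t ∷ ts} {y} (p ∷ ps) (q ∷ qs) e m with matchVar s t y in m₁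
        matchVar*-admissible (p ∷ ps) (q ∷ qs) e refl | just _ =
          matchVar-admissible p q (proj₁ (∷-injective e)) m₁
        ... | nothing = matchVar*-admissible ps qs (proj₂ (∷-injective e)) m

      mutual
        matchVar-defined : ∀ {s t y} → P s → Q t → s ⟨ θ ⟩ ≡ t ⟨ σ ⟩ ⟨ θ ⟩ →
                           y ∈ vars ar s → ∃ λ r → matchVar s t y ≡ just r
        matchVar-defined {var y} {t} _ _ _ (here refl) with y ≟ y
        ... | yes _ = t , refl
        ... | no y≢y = ⊥-elim (y≢y refl)
        matchVar-defined {fun g ss} {var x}    ps qt e _ = ⊥-elim (σθ-apart qt ps (sym e))
        matchVar-defined {fun g ss} {fun h ts} ps qt e y∈ with fun-injectiveˡ e
        ... | refl = matchVar*-defined (P-args ps) (Q-args qt) (fun-injectiveʳ e) y∈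

        matchVar*-defined : ∀ {n} {ss ts : Vec Tm n} {y} → All P ss → All Q ts →
                            ss ⟨ θ ⟩* ≡ ts ⟨ σ ⟩* ⟨ θ ⟩* → y ∈ vars* ar ss → ∃ λ r → matchVar* ss ts y ≡ just r
        matchVar*-defined {ss = s ∷ ss} {t ∷ ts} {y} (p ∷ ps) (q ∷ qs) e y∈ with ∈-++⁻ (vars ar s) y∈
        ... | inj₁ y∈s with matchVar-defined p q (proj₁ (∷-injective e)) y∈s
        ...   | r , m rewrite m = r , refl
        matchVar*-defined {ss = s ∷ ss} {t ∷ ts} {y} (p ∷ ps) (q ∷ qs) e y∈ | inj₂ y∈ss with matchVar s t y
        ...   | just r  = r , refl
        ...   | nothing = matchVar*-defined ps qs (proj₂ (∷-injective e)) y∈ss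

      mutual
        instance-of-admissible : ∀ {s t} → P s → Q t → s ⟨ θ ⟩ ≡ t ⟨ σ ⟩ ⟨ θ ⟩ → (ρ : Subst ar) →
                                 (∀ y → y ∈ vars ar s → Admissible y (ρ y)) → t ≡ s ⟨ ρ ⟩
        instance-of-admissible {var y} _ qt e ρ adm =
          let qρ , θy≡ = adm y (here refl) in σθ-injective qt qρ (trans (sym e) θy≡)
        instance-of-admissible {fun g ss} {var x}    ps qt e ρ adm = ⊥-elim (σθ-apart qt ps (sym e))
        instance-of-admissible {fun g ss} {fun h ts} ps qt e ρ adm with fun-injectiveˡ e
        ... | refl = cong (fun g) (instance-of-admissible* (P-args ps) (Q-args qt) (fun-injectiveʳ e) ρ adm)

        instance-of-admissible* : ∀ {n} {ss ts : Vec Tm n} → All P ss → All Q ts →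
                                  ss ⟨ θ ⟩* ≡ ts ⟨ σ ⟩* ⟨ θ ⟩* → (ρ : Subst ar) →
                                  (∀ y → y ∈ vars* ar ss → Admissible y (ρ y)) → ts ≡ ss ⟨ ρ ⟩*
        instance-of-admissible* {ss = []}     {[]}     _        _        _ _ _ = refl
        instance-of-admissible* {ss = s ∷ ss} {t ∷ ts} (p ∷ ps) (q ∷ qs) e ρ adm =
          let e₁ , e₂ = ∷-injective e in
          cong₂ _∷_ (instance-of-admissible p q e₁ ρ (λ y → adm y ∘ ∈-++⁺ˡ))
                    (instance-of-admissible* ps qs e₂ ρ (λ y → adm y ∘ ∈-++⁺ʳ (vars ar s)))

    unifiable⇒instance : ∀ {s t} → P s → Q t → Unifiable ar (t ⟨ σ ⟩) s → IsInstance ar t s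
    unifiable⇒instance {s} {t} ps qt (θ , e) = ρ , instance-of-admissible θ ps qt (sym e) ρ ρ-admissible
      where
      ρ : Subst ar
      ρ y = fromMaybe (var y) (matchVar s t y)

      ρ-admissible : ∀ y → y ∈ vars ar s → Admissible θ y (ρ y)
      ρ-admissible y y∈s with matchVar s t y in m | matchVar-defined θ ps qt (sym e) y∈s
      ... | just r  | _ = matchVar-admissible θ ps qt (sym e) m
      ... | nothing | _ , ()

    separating-instance : ∀ {t} → Q t →
      Σ Tm λ u → IsInstance ar u t × ((s : Tm) → ¬ IsInstance ar t s → P s → ¬ Unifiable ar u s)
    separating-instance {t} qt = t ⟨ σ ⟩ , (σ , refl) , λ s t⋢s ps u~s → t⋢s (unifiable⇒instance ps qt u~s)

  module Tower (f : F) (i : Fin (ar f)) where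

    tower : ℕ → Tm → Tm
    tower zero    u = u
    tower (suc n) u = fun f (replicate (ar f) (tower n u))

    tower-⟨⟩ : ∀ n u (θ : Subst ar) → tower n u ⟨ θ ⟩ ≡ tower n (u ⟨ θ ⟩)
    tower-⟨⟩ zero    u θ = refl
    tower-⟨⟩ (suc n) u θ =
      cong (fun f) (trans (replicate-⟨⟩* (ar f) (tower n u) θ) (cong (replicate (ar f)) (tower-⟨⟩ n u θ)))

    size-tower-step : ∀ n u → size (tower n u) < size (tower (suc n) u)
    size-tower-step n u =
      subst (λ v → size v < size (tower (suc n) u)) (lookup-replicate i (tower n u))
            (size-lookup-< (replicate (ar f) (tower n u)) i)

    size-<-tower : ∀ n u → size u < size (tower (suc n) u)
    size-<-tower zero    u = size-tower-step zero u
    size-<-tower (suc n) u = <-trans (size-<-tower n u) (size-tower-step (suc n) u)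

    tower-injective : ∀ m n {u} → tower m u ≡ tower n u → m ≡ n
    tower-injective zero    zero    e = refl
    tower-injective zero    (suc n) e = ⊥-elim (<⇒≢ (size-<-tower n _) (cong size e))
    tower-injective (suc m) zero    e = ⊥-elim (<⇒≢ (size-<-tower m _) (cong size (sym e)))
    tower-injective (suc m) (suc n) {u} e = cong suc (tower-injective m n peeled)
      where
      open ≡-Reasoning
      peeled : tower m u ≡ tower n u
      peeled = begin
        tower m u                                ≡⟨ lookup-replicate i (tower m u) ⟨
        lookup (replicate (ar f) (tower m u)) i  ≡⟨ cong (λ ts → lookup ts i) (fun-injectiveʳ e) ⟩
        lookup (replicate (ar f) (tower n u)) i  ≡⟨ lookup-replicate i (tower n u) ⟩
        tower n u                                ∎

    σ : Subst ar
    σ x = tower (suc x) (var 0)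

    σ-injective : ∀ θ {x y} → σ x ⟨ θ ⟩ ≡ σ y ⟨ θ ⟩ → x ≡ y
    σ-injective θ {x} {y} e = suc-injective (tower-injective (suc x) (suc y)
      (trans (sym (tower-⟨⟩ (suc x) (var 0) θ)) (trans e (tower-⟨⟩ (suc y) (var 0) θ))))

    Avoids-f : Tm → Set
    Avoids-f t = ¬ Occurs ar f t

    avoids-f-args : ∀ {g} {ts : Vec Tm (ar g)} → Avoids-f (fun g ts) → All Avoids-f ts
    avoids-f-args ¬o = lookup⁻ (λ j o → ¬o (occurs-lookup j o))

    σ-head : ∀ {x} → ∃₂ λ h (us : Vec Tm (ar h)) → σ x ≡ fun h us × (∀ {vs} → ¬ Avoids-f (fun h vs))
    σ-head {x} = f , replicate (ar f) (tower x (var 0)) , refl , λ {vs} ¬o → ¬o (here vs)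

    open Matching σ Avoids-f Avoids-f avoids-f-args avoids-f-args id (λ _ → σ-head) (λ θ _ _ → σ-injective θ)
      public using (separating-instance)

  module Constants (t₀ : Tm) (c : Fin (numVars ar t₀) → F)
                   (c-injective : Injective _≡_ _≡_ c) (c-nullary : ∀ i → ar (c i) ≡ 0) where

    D : List ℕ
    D = deduplicate _≟_ (vars ar t₀)

    constant : Fin (numVars ar t₀) → Tm
    constant i = fun (c i) (subst (Vec Tm) (sym (c-nullary i)) [])

    -- The no-branch is junk: Avoids-c-over-D confines the relevant variables to D.
    σ : Subst ar
    σ x with x ∈? D
    ... | yes x∈D = constant (index x∈D)
    ... | no _    = var x

    σ-∈ : ∀ {x} → x ∈ D → ∃ λ i → List.lookup D i ≡ x × σ x ≡ constant i
    σ-∈ {x} x∈D with x ∈? D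
    ... | yes x∈D′ = index x∈D′ , sym (lookup-index x∈D′) , refl
    ... | no x∉D   = ⊥-elim (x∉D x∈D)

    σ-injective : ∀ θ {x y} → x ∈ D → y ∈ D → σ x ⟨ θ ⟩ ≡ σ y ⟨ θ ⟩ → x ≡ y
    σ-injective θ x∈D y∈D e with σ-∈ x∈D | σ-∈ y∈D
    ... | i , refl , σx≡ | j , refl , σy≡ = cong (List.lookup D) (c-injective (fun-injectiveˡ
      (trans (cong (_⟨ θ ⟩) (sym σx≡)) (trans e (cong (_⟨ θ ⟩) σy≡)))))

    Avoids-c : Tm → Set
    Avoids-c t = ∀ i → ¬ Occurs ar (c i) t

    avoids-c-args : ∀ {g} {ts : Vec Tm (ar g)} → Avoids-c (fun g ts) → All Avoids-c ts
    avoids-c-args ¬o = lookup⁻ (λ j i o → ¬o i (occurs-lookup j o))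

    Avoids-c-over-D : Tm → Set
    Avoids-c-over-D t = Avoids-c t × vars ar t ⊆ D

    avoids-c-over-D-args : ∀ {g} {ts : Vec Tm (ar g)} → Avoids-c-over-D (fun g ts) → All Avoids-c-over-D ts
    avoids-c-over-D-args {ts = ts} (¬o , ⊆D) =
      lookup⁻ (λ j → (λ i o → ¬o i (occurs-lookup j o)) , ⊆D ∘ vars-lookup-⊆ ts j)

    σ-head : ∀ {x} → Avoids-c-over-D (var x) →
      ∃₂ λ h (us : Vec Tm (ar h)) → σ x ≡ fun h us × (∀ {vs} → ¬ Avoids-c (fun h vs))
    σ-head (_ , ⊆D) with σ-∈ (⊆D (here refl))
    ... | i , _ , σx≡ = c i , _ , σx≡ , λ {vs} ¬o → ¬o i (here vs)

    open Matching σ Avoids-c Avoids-c-over-D avoids-c-args avoids-c-over-D-args proj₁ σ-head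
      (λ θ (_ , ⊆D₁) (_ , ⊆D₂) → σ-injective θ (⊆D₁ (here refl)) (⊆D₂ (here refl)))
      public using (separating-instance)

lemma1 : {F : Set} (ar : F → ℕ) (t : Term ar) →
    ((f : F) → 1 ≤ ar f → ¬ Occurs ar f t →
      Σ (Term ar) λ u → IsInstance ar u t ×
        ((s : Term ar) → ¬ IsInstance ar t s → ¬ Occurs ar f s → ¬ Unifiable ar u s))
    ×
    ((c : Fin (numVars ar t) → F) → Injective _≡_ _≡_ c →
      (∀ i → ar (c i) ≡ 0) → (∀ i → ¬ Occurs ar (c i) t) →
      Σ (Term ar) λ u → IsInstance ar u t ×
        ((s : Term ar) → ¬ IsInstance ar t s → (∀ i → ¬ Occurs ar (c i) s) → ¬ Unifiable ar u s))
lemma1 ar t =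
  (λ f 1≤arity ¬f∈t → Tower.separating-instance ar f (fromℕ< 1≤arity) ¬f∈t) ,
  (λ c c-injective c-nullary ¬c∈t →
    Constants.separating-instance ar t c c-injective c-nullary (¬c∈t , ∈-deduplicate⁺ _≟_))
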